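{- For any $S\in\{S_1,\ldots,S_{15}\}$ and any positive integer $h$, $M_1=1+x+x^2$ does not divide $\sigma(S^{2h})$.
   Context: $\sigma(A)$ is the sum of all monic divisors of $A\in\mathbb{F}_2[x]$. $M_1=1+x+x^2$ and $S_1=1+x(x+1)M_1$, $S_2=1+x^2(x+1)^2M_1$, $S_3=1+x(x+1)^3M_1^4$, $S_4=1+x^3(x+1)M_1$, $S_5=1+x(x+1)^3M_1$, $S_6=1+x^3(x+1)M_1^4$, $S_7=1+x(x+1)M_1^3$, $S_8=1+x^3(x+1)^3M_1$, $S_9=1+x(x+1)M_1^5$, $S_{10}=1+x^4(x+1)M_1$, $S_{11}=1+x(x+1)^2M_1$, $S_{12}=1+x^2(x+1)M_1^2$, $S_{13}=1+x(x+1)^4M_1$, $S_{14}=1+x^2(x+1)M_1$, $S_{15}=1+x(x+1)^2M_1^2$; all are irreducible over $\mathbb{F}_2$. -}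

module Defs where

-- Polynomials over F₂ represented as coefficient lists, lowest degree first
-- (true = 1, false = 0).  All arithmetic operations return the canonical
-- (normalized) representative: no trailing zero coefficients.  So the zero
-- polynomial is [] and ≡ on normalized lists is equality of polynomials.

open import Data.Bool using (Bool; true; false; if_then_else_; _xor_)
open import Data.List using (List; []; _∷_; _++_; length; replicate; concatMap; upTo; foldr; null; filterᵇ)
open import Data.Nat using (ℕ; zero; suc; _<ᵇ_; _∸_)
open import Data.Product using (Σ)
open import Relation.Binary.PropositionalEquality using (_≡_)

Poly : Set
Poly = List Bool

norm : Poly → Poly
norm [] = []
norm (b ∷ bs) with norm bs
... | [] = if b then true ∷ [] else []
... | c ∷ cs = b ∷ c ∷ cs

addRaw : Poly → Poly → Poly
addRaw [] q = q
addRaw (a ∷ p) [] = a ∷ p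
addRaw (a ∷ p) (b ∷ q) = (a xor b) ∷ addRaw p q

mulRaw : Poly → Poly → Poly
mulRaw [] q = []
mulRaw (b ∷ p) q = addRaw (if b then q else []) (false ∷ mulRaw p q)

infixl 6 _+ₚ_
infixl 7 _*ₚ_
infixr 8 _^ₚ_

_+ₚ_ : Poly → Poly → Poly
p +ₚ q = norm (addRaw p q)

_*ₚ_ : Poly → Poly → Poly
p *ₚ q = norm (mulRaw p q)

1ₚ : Poly
1ₚ = true ∷ []

_^ₚ_ : Poly → ℕ → Poly
p ^ₚ zero = 1ₚ
p ^ₚ suc n = p *ₚ (p ^ₚ n)

infix 4 _∣ₚ_
_∣ₚ_ : Poly → Poly → Set
D ∣ₚ A = Σ Poly (λ Q → Q *ₚ D ≡ norm A)

-- remainder of A modulo a nonzero normalized D, by long division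
-- (fuel = number of reduction steps; length A steps always suffice)
remFuel : ℕ → Poly → Poly → Poly
remFuel zero A D = A
remFuel (suc k) A D =
  if length A <ᵇ length D then A
  else remFuel k (A +ₚ (replicate (length A ∸ length D) false ++ D)) D

rem : Poly → Poly → Poly
rem A D = remFuel (length (norm A)) (norm A) (norm D)

allBits : ℕ → List (List Bool)
allBits zero = [] ∷ []
allBits (suc n) = concatMap (λ l → (false ∷ l) ∷ (true ∷ l) ∷ []) (allBits n)

monicsOfDeg : ℕ → List Poly
monicsOfDeg d = concatMap (λ l → (l ++ true ∷ []) ∷ []) (allBits d)

-- all monic polynomials of degree ≤ deg A (for A ≠ 0)
monicCandidates : Poly → List Poly
monicCandidates A = concatMap monicsOfDeg (upTo (length (norm A)))

monicDivisors : Poly → List Poly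
monicDivisors A = filterᵇ (λ D → null (rem A D)) (monicCandidates A)

σ : Poly → Poly
σ A = foldr _+ₚ_ [] (monicDivisors A)

X : Poly
X = false ∷ true ∷ []

X+1 : Poly
X+1 = true ∷ true ∷ []

M₁ : Poly
M₁ = true ∷ true ∷ true ∷ []

mkS : ℕ → ℕ → ℕ → Poly
mkS a b c = 1ₚ +ₚ (X ^ₚ a) *ₚ (X+1 ^ₚ b) *ₚ (M₁ ^ₚ c)

S₁ S₂ S₃ S₄ S₅ S₆ S₇ S₈ S₉ S₁₀ S₁₁ S₁₂ S₁₃ S₁₄ S₁₅ : Poly
S₁  = mkS 1 1 1
S₂  = mkS 2 2 1
S₃  = mkS 1 3 4
S₄  = mkS 3 1 1
S₅  = mkS 1 3 1
S₆  = mkS 3 1 4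
S₇  = mkS 1 1 3
S₈  = mkS 3 3 1
S₉  = mkS 1 1 5
S₁₀ = mkS 4 1 1
S₁₁ = mkS 1 2 1
S₁₂ = mkS 2 1 2
S₁₃ = mkS 1 4 1
S₁₄ = mkS 2 1 1
S₁₅ = mkS 1 2 2

SList : List Poly
SList = S₁ ∷ S₂ ∷ S₃ ∷ S₄ ∷ S₅ ∷ S₆ ∷ S₇ ∷ S₈ ∷ S₉ ∷ S₁₀ ∷ S₁₁ ∷ S₁₂ ∷ S₁₃ ∷ S₁₄ ∷ S₁₅ ∷ []

-- Each S is irreducible, as trial division by all monic polynomials of smaller
-- positive degree shows. By Euclid's lemma the monic divisors of S ^ N are then
-- exactly 1, S, …, S ^ N, so σ (S ^ N) = 1 + S + ⋯ + S ^ N. Since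
-- S = 1 + x^a (x+1)^b M₁^c with c ≥ 1, we have S ≡ 1 (mod M₁), hence
-- σ (S ^ 2h) ≡ 2h + 1 ≡ 1 (mod M₁).

module Submission where

open import Defs
open import Algebra.Bundles using (CommutativeRing)
open import Algebra.Definitions using (Associative; Commutative; RightIdentity; LeftIdentity; _DistributesOverʳ_; _DistributesOverˡ_; Congruent₂)
open import Data.Bool using (Bool; true; false; if_then_else_; _xor_)
open import Data.Bool.Properties as Bool using (xor-assoc; xor-comm; xor-same; xor-identityʳ)
open import Data.Empty using (⊥-elim)
open import Data.List using (List; []; _∷_; _++_; length; replicate; null; upTo; foldr; concatMap; filterᵇ)
open import Data.List.Membership.Propositional using (_∈_)
open import Data.List.Membership.Propositional.Properties using (∈-concat⁺′; ∈-map⁺; ∈-upTo⁺)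
open import Data.List.Properties using (≡-dec; length-++; length-replicate; upTo-∷ʳ; ++-cancelʳ)
open import Data.List.Relation.Unary.All using (All; lookup; all?)
open import Data.List.Relation.Unary.Any using (here; there)
open import Data.Maybe using (nothing)
open import Data.Nat using (ℕ; zero; suc; _+_; _*_; _∸_; _≤_; _<_; z≤n; s≤s; z<s; _<ᵇ_; _≟_)
open import Data.Nat.Properties using (≤-refl; ≤-trans; ≤-reflexive; m≤n+m; suc-injective; <⇒≱; +-mono-≤; +-∸-comm; ≤-pred; ≮⇒≥; m∸n+n≡m; <ᵇ-reflects-<; +-suc; n≤1+n; +-cancelʳ-≡; +-comm; ≤∧≢⇒<; _≤?_; m<m+n; *-monoˡ-≤; <-irrefl; +-monoʳ-<; ≰⇒>; +-identityʳ; *-cancelʳ-≡; *-suc; module ≤-Reasoning)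
open import Data.Product using (Σ; _×_; _,_; proj₁; proj₂)
open import Data.Sum using (_⊎_; inj₁; inj₂)
open import Level using (0ℓ)
open import Relation.Binary.Bundles using (Setoid)
open import Relation.Binary.PropositionalEquality using (_≡_; _≢_; refl; sym; trans; cong; cong₂; subst; subst₂; module ≡-Reasoning)
import Relation.Binary.Reasoning.Setoid as SetoidReasoning
open import Relation.Nullary using (¬_; Dec; yes; no; ofʸ; ofⁿ; ¬?)
open import Relation.Nullary.Decidable using (True; toWitness)
open import Tactic.RingSolver using (solve-∀; solve)
open import Tactic.RingSolver.Core.AlmostCommutativeRing using (AlmostCommutativeRing; fromCommutativeRing)

-- The ring F₂[x]: unnormalised operations, coefficientwise equality

infixl 6 _⊕_
infixl 7 _⊗_

_⊕_ : Poly → Poly → Poly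
_⊕_ = addRaw

_⊗_ : Poly → Poly → Poly
_⊗_ = mulRaw

coeff : Poly → ℕ → Bool
coeff [] _ = false
coeff (b ∷ p) zero = b
coeff (b ∷ p) (suc i) = coeff p i

infix 4 _≈_
record _≈_ (p q : Poly) : Set where
  constructor mk≈
  field coeff-≡ : ∀ i → coeff p i ≡ coeff q i
open _≈_

≈-refl : ∀ {p} → p ≈ p
≈-refl = mk≈ λ i → refl

≈-sym : ∀ {p q} → p ≈ q → q ≈ p
≈-sym p≈q = mk≈ λ i → sym (coeff-≡ p≈q i)

≈-trans : ∀ {p q r} → p ≈ q → q ≈ r → p ≈ r
≈-trans p≈q q≈r = mk≈ λ i → trans (coeff-≡ p≈q i) (coeff-≡ q≈r i)

≡⇒≈ : ∀ {p q} → p ≡ q → p ≈ q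
≡⇒≈ refl = ≈-refl

≈-setoid : Setoid 0ℓ 0ℓ
≈-setoid = record
  { Carrier = Poly
  ; _≈_ = _≈_
  ; isEquivalence = record { refl = ≈-refl ; sym = ≈-sym ; trans = ≈-trans }
  }

module ≈-Reasoning = SetoidReasoning ≈-setoid

∷-cong : ∀ {a b p q} → a ≡ b → p ≈ q → a ∷ p ≈ b ∷ q
∷-cong a≡b p≈q = mk≈ λ { zero → a≡b ; (suc i) → coeff-≡ p≈q i }

∷-injectiveʳ : ∀ {a b p q} → a ∷ p ≈ b ∷ q → p ≈ q
∷-injectiveʳ h = mk≈ λ i → coeff-≡ h (suc i)

∷-injectiveˡ : ∀ {a b p q} → a ∷ p ≈ b ∷ q → a ≡ b
∷-injectiveˡ h = coeff-≡ h zero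

false∷-≈[] : ∀ {p} → p ≈ [] → false ∷ p ≈ []
false∷-≈[] p≈0 = mk≈ λ { zero → refl ; (suc i) → coeff-≡ p≈0 i }

≈[]-tail : ∀ {b p} → b ∷ p ≈ [] → p ≈ []
≈[]-tail h = mk≈ λ i → coeff-≡ h (suc i)

coeff-norm : ∀ p i → coeff (norm p) i ≡ coeff p i
coeff-norm [] i = refl
coeff-norm (b ∷ bs) i with norm bs | coeff-norm bs
coeff-norm (true ∷ bs) zero | [] | _ = refl
coeff-norm (false ∷ bs) zero | [] | _ = refl
coeff-norm (true ∷ bs) (suc i) | [] | ih = ih i
coeff-norm (false ∷ bs) (suc i) | [] | ih = ih i
coeff-norm (b ∷ bs) zero | c ∷ cs | _ = refl
coeff-norm (b ∷ bs) (suc i) | c ∷ cs | ih = ih i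

norm-≈ : ∀ p → norm p ≈ p
norm-≈ p = mk≈ (coeff-norm p)

coeff-⊕ : ∀ p q i → coeff (p ⊕ q) i ≡ coeff p i xor coeff q i
coeff-⊕ [] q i = refl
coeff-⊕ (a ∷ p) [] i = sym (xor-identityʳ (coeff (a ∷ p) i))
coeff-⊕ (a ∷ p) (b ∷ q) zero = refl
coeff-⊕ (a ∷ p) (b ∷ q) (suc i) = coeff-⊕ p q i

⊕-cong : Congruent₂ _≈_ _⊕_
⊕-cong {p} {p'} {q} {q'} p≈p' q≈q' = mk≈ λ i → begin
  coeff (p ⊕ q) i             ≡⟨ coeff-⊕ p q i ⟩
  coeff p i xor coeff q i     ≡⟨ cong₂ _xor_ (coeff-≡ p≈p' i) (coeff-≡ q≈q' i) ⟩
  coeff p' i xor coeff q' i   ≡⟨ coeff-⊕ p' q' i ⟨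
  coeff (p' ⊕ q') i           ∎
  where open ≡-Reasoning

⊕-comm : Commutative _≈_ _⊕_
⊕-comm p q = mk≈ λ i → begin
  coeff (p ⊕ q) i          ≡⟨ coeff-⊕ p q i ⟩
  coeff p i xor coeff q i  ≡⟨ xor-comm (coeff p i) (coeff q i) ⟩
  coeff q i xor coeff p i  ≡⟨ coeff-⊕ q p i ⟨
  coeff (q ⊕ p) i          ∎
  where open ≡-Reasoning

⊕-identityʳ : RightIdentity _≈_ [] _⊕_
⊕-identityʳ p = mk≈ λ i → trans (coeff-⊕ p [] i) (xor-identityʳ (coeff p i))

⊕-assoc : Associative _≈_ _⊕_
⊕-assoc p q r = mk≈ λ i → begin
  coeff ((p ⊕ q) ⊕ r) i                  ≡⟨ coeff-⊕ (p ⊕ q) r i ⟩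
  coeff (p ⊕ q) i xor coeff r i          ≡⟨ cong (_xor coeff r i) (coeff-⊕ p q i) ⟩
  (coeff p i xor coeff q i) xor coeff r i ≡⟨ xor-assoc (coeff p i) (coeff q i) (coeff r i) ⟩
  coeff p i xor (coeff q i xor coeff r i) ≡⟨ cong (coeff p i xor_) (coeff-⊕ q r i) ⟨
  coeff p i xor coeff (q ⊕ r) i          ≡⟨ coeff-⊕ p (q ⊕ r) i ⟨
  coeff (p ⊕ (q ⊕ r)) i                  ∎
  where open ≡-Reasoning

⊕-inverse : ∀ p → p ⊕ p ≈ []
⊕-inverse p = mk≈ λ i → trans (coeff-⊕ p p i) (xor-same (coeff p i))

data Monic : Poly → Set where
  one : Monic (true ∷ [])
  cons : ∀ b {c p} → Monic (c ∷ p) → Monic (b ∷ c ∷ p)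

data Normal : Poly → Set where
  nil : Normal []
  monic : ∀ {p} → Monic p → Normal p

normal-norm : ∀ p → Normal (norm p)
normal-norm [] = nil
normal-norm (b ∷ bs) with norm bs | normal-norm bs
normal-norm (true ∷ bs) | [] | _ = monic one
normal-norm (false ∷ bs) | [] | _ = nil
... | c ∷ cs | monic m = monic (cons b m)

monic-≉[] : ∀ {p} → Monic p → ¬ (p ≈ [])
monic-≉[] one h with coeff-≡ h zero
... | ()
monic-≉[] (cons b m) h = monic-≉[] m (≈[]-tail h)

monic-unique : ∀ {p q} → Monic p → Monic q → p ≈ q → p ≡ q
monic-unique one one h = refl
monic-unique one (cons b m) h = ⊥-elim (monic-≉[] m (≈-sym (∷-injectiveʳ h)))
monic-unique (cons b m) one h = ⊥-elim (monic-≉[] m (∷-injectiveʳ h))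
monic-unique (cons b m) (cons b' m') h =
  cong₂ _∷_ (∷-injectiveˡ h) (monic-unique m m' (∷-injectiveʳ h))

normal-unique : ∀ {p q} → Normal p → Normal q → p ≈ q → p ≡ q
normal-unique nil nil h = refl
normal-unique nil (monic m) h = ⊥-elim (monic-≉[] m (≈-sym h))
normal-unique (monic m) nil h = ⊥-elim (monic-≉[] m h)
normal-unique (monic m) (monic m') h = monic-unique m m' h

norm-normal : ∀ {p} → Normal p → norm p ≡ p
norm-normal {p} n = normal-unique (normal-norm p) n (norm-≈ p)

≈⇒norm≡ : ∀ {p q} → p ≈ q → norm p ≡ norm q
≈⇒norm≡ {p} {q} h = normal-unique (normal-norm p) (normal-norm q)
  (≈-trans (norm-≈ p) (≈-trans h (≈-sym (norm-≈ q))))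

infixr 8 _·_

_·_ : Bool → Poly → Poly
b · q = if b then q else []

·-cong : ∀ b {q q'} → q ≈ q' → b · q ≈ b · q'
·-cong true h = h
·-cong false h = ≈-refl

·-distrib-⊕ : ∀ b q q' → b · (q ⊕ q') ≈ b · q ⊕ b · q'
·-distrib-⊕ true q q' = ≈-refl
·-distrib-⊕ false q q' = ≈-refl

xor-distrib-· : ∀ a b q → (a xor b) · q ≈ a · q ⊕ b · q
xor-distrib-· true true q = ≈-sym (⊕-inverse q)
xor-distrib-· true false q = ≈-sym (⊕-identityʳ q)
xor-distrib-· false b q = ≈-refl

⊗-zeroˡ : ∀ {p} q → p ≈ [] → p ⊗ q ≈ []
⊗-zeroˡ {[]} q h = ≈-refl
⊗-zeroˡ {b ∷ p} q h with coeff-≡ h zero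
... | refl = false∷-≈[] (⊗-zeroˡ q (≈[]-tail h))

⊗-zeroʳ : ∀ p → p ⊗ [] ≈ []
⊗-zeroʳ [] = ≈-refl
⊗-zeroʳ (true ∷ p) = false∷-≈[] (⊗-zeroʳ p)
⊗-zeroʳ (false ∷ p) = false∷-≈[] (⊗-zeroʳ p)

⊗-congˡ : ∀ {p p'} q → p ≈ p' → p ⊗ q ≈ p' ⊗ q
⊗-congˡ {[]} q h = ≈-sym (⊗-zeroˡ q (≈-sym h))
⊗-congˡ {b ∷ p} {[]} q h = ⊗-zeroˡ q h
⊗-congˡ {b ∷ p} {b' ∷ p'} q h with ∷-injectiveˡ h
... | refl = ⊕-cong (≈-refl {b · q}) (∷-cong refl (⊗-congˡ q (∷-injectiveʳ h)))

⊗-congʳ : ∀ p {q q'} → q ≈ q' → p ⊗ q ≈ p ⊗ q'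
⊗-congʳ [] h = ≈-refl
⊗-congʳ (b ∷ p) h = ⊕-cong (·-cong b h) (∷-cong refl (⊗-congʳ p h))

⊗-cong : Congruent₂ _≈_ _⊗_
⊗-cong {p} {p'} h k = ≈-trans (⊗-congˡ _ h) (⊗-congʳ p' k)

⊕-interchange : ∀ a b c d → (a ⊕ b) ⊕ (c ⊕ d) ≈ (a ⊕ c) ⊕ (b ⊕ d)
⊕-interchange a b c d = begin
  (a ⊕ b) ⊕ (c ⊕ d)  ≈⟨ ⊕-assoc a b (c ⊕ d) ⟩
  a ⊕ (b ⊕ (c ⊕ d))  ≈⟨ ⊕-cong (≈-refl {a}) (⊕-assoc b c d) ⟨
  a ⊕ ((b ⊕ c) ⊕ d)  ≈⟨ ⊕-cong (≈-refl {a}) (⊕-cong (⊕-comm b c) (≈-refl {d})) ⟩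
  a ⊕ ((c ⊕ b) ⊕ d)  ≈⟨ ⊕-cong (≈-refl {a}) (⊕-assoc c b d) ⟩
  a ⊕ (c ⊕ (b ⊕ d))  ≈⟨ ⊕-assoc a c (b ⊕ d) ⟨
  (a ⊕ c) ⊕ (b ⊕ d)  ∎
  where open ≈-Reasoning

⊗-distribʳ-⊕ : _DistributesOverʳ_ _≈_ _⊗_ _⊕_
⊗-distribʳ-⊕ q [] p' = ≈-refl
⊗-distribʳ-⊕ q (b ∷ p) [] = ≈-sym (⊕-identityʳ _)
⊗-distribʳ-⊕ q (b ∷ p) (b' ∷ p') =
  ≈-trans (⊕-cong (xor-distrib-· b b' q) (∷-cong refl (⊗-distribʳ-⊕ q p p')))
          (⊕-interchange (b · q) (b' · q) (false ∷ p ⊗ q) (false ∷ p' ⊗ q))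

⊗-distribˡ-⊕ : _DistributesOverˡ_ _≈_ _⊗_ _⊕_
⊗-distribˡ-⊕ [] q q' = ≈-refl
⊗-distribˡ-⊕ (b ∷ p) q q' =
  ≈-trans (⊕-cong (·-distrib-⊕ b q q') (∷-cong refl (⊗-distribˡ-⊕ p q q')))
          (⊕-interchange (b · q) (b · q') (false ∷ p ⊗ q) (false ∷ p ⊗ q'))

⊗-shiftʳ : ∀ p q → p ⊗ (false ∷ q) ≈ false ∷ p ⊗ q
⊗-shiftʳ [] q = ≈-sym (false∷-≈[] ≈-refl)
⊗-shiftʳ (true ∷ p) q = ∷-cong refl (⊕-cong (≈-refl {q}) (⊗-shiftʳ p q))
⊗-shiftʳ (false ∷ p) q = ∷-cong refl (⊗-shiftʳ p q)

⊗-identityˡ : LeftIdentity _≈_ 1ₚ _⊗_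
⊗-identityˡ p = ≈-trans (⊕-cong (≈-refl {p}) (false∷-≈[] ≈-refl)) (⊕-identityʳ p)

⊗-identityʳ : RightIdentity _≈_ 1ₚ _⊗_
⊗-identityʳ [] = ≈-refl
⊗-identityʳ (true ∷ p) = ∷-cong refl (⊗-identityʳ p)
⊗-identityʳ (false ∷ p) = ∷-cong refl (⊗-identityʳ p)

⊗-constʳ : ∀ b p → p ⊗ (b ∷ []) ≈ b · p
⊗-constʳ true p = ⊗-identityʳ p
⊗-constʳ false p = ≈-trans (⊗-congʳ p (false∷-≈[] ≈-refl)) (⊗-zeroʳ p)

⊗-comm : Commutative _≈_ _⊗_
⊗-comm [] q = ≈-sym (⊗-zeroʳ q)
⊗-comm (b ∷ p) q = begin
  b · q ⊕ (false ∷ p ⊗ q)      ≈⟨ ⊕-cong (⊗-constʳ b q) (∷-cong refl (⊗-comm q p)) ⟨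
  q ⊗ (b ∷ []) ⊕ (false ∷ q ⊗ p) ≈⟨ ⊕-cong (≈-refl {q ⊗ (b ∷ [])}) (⊗-shiftʳ q p) ⟨
  q ⊗ (b ∷ []) ⊕ q ⊗ (false ∷ p) ≈⟨ ⊗-distribˡ-⊕ q (b ∷ []) (false ∷ p) ⟨
  q ⊗ ((b ∷ []) ⊕ (false ∷ p))   ≈⟨ ⊗-congʳ q (∷-cong (xor-identityʳ b) ≈-refl) ⟩
  q ⊗ (b ∷ p)                    ∎
  where open ≈-Reasoning

·-⊗ : ∀ b q r → (b · q) ⊗ r ≡ b · (q ⊗ r)
·-⊗ true q r = refl
·-⊗ false q r = refl

⊗-assoc : Associative _≈_ _⊗_
⊗-assoc [] q r = ≈-refl
⊗-assoc (b ∷ p) q r =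
  ≈-trans (⊗-distribʳ-⊕ r (b · q) (false ∷ p ⊗ q))
          (⊕-cong (≡⇒≈ (·-⊗ b q r)) (∷-cong refl (⊗-assoc p q r)))

-- Characteristic 2: negation is the identity.
F₂[x] : CommutativeRing 0ℓ 0ℓ
F₂[x] = record
  { Carrier = Poly ; _≈_ = _≈_ ; _+_ = _⊕_ ; _*_ = _⊗_ ; -_ = λ p → p ; 0# = [] ; 1# = 1ₚ
  ; isCommutativeRing = record
    { isRing = record
      { +-isAbelianGroup = record
        { isGroup = record
          { isMonoid = record
            { isSemigroup = record
              { isMagma = record { isEquivalence = Setoid.isEquivalence ≈-setoid ; ∙-cong = ⊕-cong }
              ; assoc = ⊕-assoc
              }
            ; identity = (λ p → ≈-refl) , ⊕-identityʳ
            }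
          ; inverse = ⊕-inverse , ⊕-inverse
          ; ⁻¹-cong = λ h → h
          }
        ; comm = ⊕-comm
        }
      ; *-cong = ⊗-cong
      ; *-assoc = ⊗-assoc
      ; *-identity = ⊗-identityˡ , ⊗-identityʳ
      ; distrib = ⊗-distribˡ-⊕ , ⊗-distribʳ-⊕
      }
    ; *-comm = ⊗-comm
    }
  }

-- The solver only knows identities of all commutative rings, so cancellations
-- x ⊕ x ≈ [] are applied by hand after it.
ring : AlmostCommutativeRing 0ℓ 0ℓ
ring = fromCommutativeRing F₂[x] (λ _ → nothing)

⊕-cancel : ∀ x y → x ⊕ (x ⊕ y) ≈ y
⊕-cancel x y = begin
  x ⊕ (x ⊕ y)  ≈⟨ ⊕-assoc x x y ⟨
  (x ⊕ x) ⊕ y  ≈⟨ ⊕-cong (⊕-inverse x) (≈-refl {y}) ⟩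
  y            ∎
  where open ≈-Reasoning

⊕≈[]⇒≈ : ∀ {x y} → x ⊕ y ≈ [] → x ≈ y
⊕≈[]⇒≈ {x} {y} h = begin
  x            ≈⟨ ⊕-cancel y x ⟨
  y ⊕ (y ⊕ x)  ≈⟨ ⊕-cong (≈-refl {y}) (≈-trans (⊕-comm y x) h) ⟩
  y ⊕ []       ≈⟨ ⊕-identityʳ y ⟩
  y            ∎
  where open ≈-Reasoning

⊕-cancel-inner : ∀ x a r → x ⊕ ((a ⊕ x) ⊕ r) ≈ a ⊕ r
⊕-cancel-inner x a r = begin
  x ⊕ ((a ⊕ x) ⊕ r)  ≈⟨ solve (x ∷ a ∷ r ∷ []) ring ⟩
  x ⊕ (x ⊕ (a ⊕ r))  ≈⟨ ⊕-cancel x (a ⊕ r) ⟩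
  a ⊕ r              ∎
  where open ≈-Reasoning

-- Degrees and division with remainder

⊕-longer : ∀ {x y} → length x < length y → Monic y → Monic (x ⊕ y) × length (x ⊕ y) ≡ length y
⊕-longer {[]} lt m = m , refl
⊕-longer {a ∷ x} {b ∷ []} (s≤s ()) one
⊕-longer {a ∷ x} {b ∷ c ∷ y} (s≤s lt) (cons .b m) with x ⊕ (c ∷ y) | ⊕-longer {x} lt m
... | d ∷ r | m' , e = cons (a xor b) m' , cong suc e

⊕-identityʳ-≡ : ∀ p → p ⊕ [] ≡ p
⊕-identityʳ-≡ [] = refl
⊕-identityʳ-≡ (a ∷ p) = refl

·-length : ∀ b q → length (b · q) ≤ length q
·-length true q = ≤-refl
·-length false q = z≤n

monic-⊗ : ∀ {p q} → Monic p → Monic q → Monic (p ⊗ q) × suc (length (p ⊗ q)) ≡ length p + length q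
monic-⊗ {q = []} _ ()
monic-⊗ {q = d ∷ q} one mq rewrite ⊕-identityʳ-≡ q | xor-identityʳ d = mq , refl
monic-⊗ {b ∷ c ∷ p} {q} (cons b mp) mq with (c ∷ p) ⊗ q | monic-⊗ mp mq
... | r ∷ rs | mr , e = proj₁ longer , cong suc (trans (proj₂ longer) e)
  where
  shorter : length (b · q) < length (false ∷ r ∷ rs)
  shorter = s≤s (≤-trans (·-length b q) (≤-trans (m≤n+m (length q) (length p)) (≤-reflexive (sym (suc-injective e)))))
  longer : Monic (b · q ⊕ (false ∷ r ∷ rs)) × length (b · q ⊕ (false ∷ r ∷ rs)) ≡ suc (length (r ∷ rs))
  longer = ⊕-longer shorter (cons false mr)

len : Poly → ℕ
len p = length (norm p)

len-cong : ∀ {p q} → p ≈ q → len p ≡ len q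
len-cong h = cong length (≈⇒norm≡ h)

len-normal : ∀ {p} → Normal p → len p ≡ length p
len-normal n = cong length (norm-normal n)

len-monic : ∀ {p} → Monic p → len p ≡ length p
len-monic m = len-normal (monic m)

Nonzero : Poly → Set
Nonzero p = ¬ (p ≈ [])

monic-norm : ∀ {p} → Nonzero p → Monic (norm p)
monic-norm {p} p≉0 with norm p | normal-norm p | norm-≈ p
... | [] | nil | e = ⊥-elim (p≉0 (≈-sym e))
... | _ | monic m | _ = m

monic-length-pos : ∀ {p} → Monic p → 1 ≤ length p
monic-length-pos one = s≤s z≤n
monic-length-pos (cons b m) = s≤s z≤n

len-pos : ∀ {p} → Nonzero p → 1 ≤ len p
len-pos p≉0 = monic-length-pos (monic-norm p≉0)

len-⊗ : ∀ {p q} → Nonzero p → Nonzero q → suc (len (p ⊗ q)) ≡ len p + len q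
len-⊗ {p} {q} p≉0 q≉0 = begin
  suc (len (p ⊗ q))                   ≡⟨ cong suc (len-cong (⊗-cong (norm-≈ p) (norm-≈ q))) ⟨
  suc (len (norm p ⊗ norm q))         ≡⟨ cong suc (len-monic (proj₁ product)) ⟩
  suc (length (norm p ⊗ norm q))      ≡⟨ proj₂ product ⟩
  len p + len q                       ∎
  where
  open ≡-Reasoning
  product : Monic (norm p ⊗ norm q) × suc (length (norm p ⊗ norm q)) ≡ len p + len q
  product = monic-⊗ (monic-norm p≉0) (monic-norm q≉0)

⊗-nonzero : ∀ {p q} → Nonzero p → Nonzero q → Nonzero (p ⊗ q)
⊗-nonzero p≉0 q≉0 pq≈0 = <⇒≱ (+-mono-≤ (len-pos p≉0) (len-pos q≉0))
  (≤-reflexive (trans (sym (len-⊗ p≉0 q≉0)) (cong suc (len-cong pq≈0))))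

≈[]? : ∀ p → Dec (p ≈ [])
≈[]? p with norm p | normal-norm p | norm-≈ p
... | [] | nil | e = yes (≈-sym e)
... | _ | monic m | e = no λ p≈0 → monic-≉[] m (≈-trans e p≈0)

⊗-cancelˡ : ∀ {s x y} → Nonzero s → s ⊗ x ≈ s ⊗ y → x ≈ y
⊗-cancelˡ {s} {x} {y} s≉0 h with ≈[]? (x ⊕ y)
... | yes x+y≈0 = ⊕≈[]⇒≈ x+y≈0
... | no x+y≉0 = ⊥-elim (⊗-nonzero s≉0 x+y≉0 (begin
  s ⊗ (x ⊕ y)      ≈⟨ ⊗-distribˡ-⊕ s x y ⟩
  s ⊗ x ⊕ s ⊗ y    ≈⟨ ⊕-cong h (≈-refl {s ⊗ y}) ⟩
  s ⊗ y ⊕ s ⊗ y    ≈⟨ ⊕-inverse (s ⊗ y) ⟩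
  []               ∎))
  where open ≈-Reasoning

infix 4 _∣_
_∣_ : Poly → Poly → Set
D ∣ A = Σ Poly λ Q → Q ⊗ D ≈ A

∣-respʳ : ∀ {D A A'} → A ≈ A' → D ∣ A → D ∣ A'
∣-respʳ h (Q , e) = Q , ≈-trans e h

∣-respˡ : ∀ {D D' A} → D ≈ D' → D ∣ A → D' ∣ A
∣-respˡ h (Q , e) = Q , ≈-trans (⊗-congʳ Q (≈-sym h)) e

∣-refl : ∀ {D} → D ∣ D
∣-refl {D} = 1ₚ , ⊗-identityˡ D

∣-⊕ : ∀ {D A B} → D ∣ A → D ∣ B → D ∣ A ⊕ B
∣-⊕ {D} (Q , e) (Q' , e') = Q ⊕ Q' , ≈-trans (⊗-distribʳ-⊕ D Q Q') (⊕-cong e e')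

∣-⊗ˡ : ∀ {D A} C → D ∣ A → D ∣ C ⊗ A
∣-⊗ˡ {D} C (Q , e) = C ⊗ Q , ≈-trans (⊗-assoc C Q D) (⊗-congʳ C e)

∣-⊗ʳ : ∀ {A B} C → A ∣ B → A ⊗ C ∣ B ⊗ C
∣-⊗ʳ {A} C (Q , e) = Q , ≈-trans (≈-sym (⊗-assoc Q A C)) (⊗-congˡ C e)

∣-cancelˡ : ∀ {S D A} → Nonzero S → S ⊗ D ∣ S ⊗ A → D ∣ A
∣-cancelˡ {S} {D} {A} S≉0 (Q , e) = Q , ⊗-cancelˡ S≉0 (begin
  S ⊗ (Q ⊗ D)  ≈⟨ solve (S ∷ Q ∷ D ∷ []) ring ⟩
  Q ⊗ (S ⊗ D)  ≈⟨ e ⟩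
  S ⊗ A        ∎)
  where open ≈-Reasoning

∣-shift : ∀ m D → D ∣ replicate m false ++ D
∣-shift zero D = ∣-refl
∣-shift (suc m) D with ∣-shift m D
... | Q , e = false ∷ Q , ∷-cong refl e

∣-len : ∀ {D A} → Monic D → D ∣ A → Nonzero A → length D ≤ len A
∣-len {D} {A} mD (Q , e) A≉0 = begin
  length D               ≡⟨ len-monic mD ⟨
  len D                  ≤⟨ m≤n+m (len D) (len Q ∸ 1) ⟩
  len Q ∸ 1 + len D      ≡⟨ +-∸-comm (len D) (len-pos Q≉0) ⟨
  len Q + len D ∸ 1      ≡⟨ cong (_∸ 1) (len-⊗ Q≉0 D≉0) ⟨
  len (Q ⊗ D)            ≡⟨ len-cong e ⟩
  len A                  ∎
  where
  open ≤-Reasoning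
  D≉0 : Nonzero D
  D≉0 = monic-≉[] mD
  Q≉0 : Nonzero Q
  Q≉0 Q≈0 = A≉0 (≈-trans (≈-sym e) (⊗-zeroˡ D Q≈0))

∣-⊕-remFuel : ∀ k A D → D ∣ A ⊕ remFuel k A D
∣-⊕-remFuel zero A D = [] , ≈-sym (⊕-inverse A)
∣-⊕-remFuel (suc k) A D with length A <ᵇ length D
... | true = [] , ≈-sym (⊕-inverse A)
... | false = ∣-respʳ reduce (∣-⊕ (∣-shift m D) (∣-⊕-remFuel k (A +ₚ Dₘ) D))
  where
  m : ℕ
  m = length A ∸ length D
  Dₘ R : Poly
  Dₘ = replicate m false ++ D
  R = remFuel k (A +ₚ Dₘ) D
  reduce : Dₘ ⊕ ((A +ₚ Dₘ) ⊕ R) ≈ A ⊕ R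
  reduce = ≈-trans (⊕-cong (≈-refl {Dₘ}) (⊕-cong (norm-≈ (A ⊕ Dₘ)) (≈-refl {R}))) (⊕-cancel-inner Dₘ A R)

monic-∷ : ∀ b {p} → Monic p → Monic (b ∷ p)
monic-∷ b one = cons b one
monic-∷ b (cons c m) = cons b (cons c m)

monic-shift : ∀ m {D} → Monic D → Monic (replicate m false ++ D)
monic-shift zero mD = mD
monic-shift (suc m) mD = monic-∷ false (monic-shift m mD)

normal-nonempty : ∀ {p} → Normal p → 1 ≤ length p → Monic p
normal-nonempty (monic m) _ = m

len-∷ : ∀ b p → len (b ∷ p) ≤ suc (len p)
len-∷ b p with norm p
len-∷ true p | [] = ≤-refl
len-∷ false p | [] = z≤n
... | c ∷ cs = ≤-refl

⊕-top-cancel : ∀ {A B} → Monic A → Monic B → length A ≡ length B → len (A ⊕ B) < length A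
⊕-top-cancel one one _ = s≤s z≤n
⊕-top-cancel one (cons b m) ()
⊕-top-cancel (cons a m) one ()
⊕-top-cancel (cons a {c} {A} mA) (cons b {d} {B} mB) e =
  ≤-trans (s≤s (len-∷ (a xor b) ((c ∷ A) ⊕ (d ∷ B)))) (s≤s (⊕-top-cancel mA mB (suc-injective e)))

remFuel-small : ∀ k A {D} → Normal A → Monic D → length A ≤ k →
  Normal (remFuel k A D) × length (remFuel k A D) < length D
remFuel-small zero [] nA mD _ = nil , monic-length-pos mD
remFuel-small (suc k) A {D} nA mD A≤k
  with length A <ᵇ length D | <ᵇ-reflects-< (length A) (length D)
... | true | ofʸ A<D = nA , A<D
... | false | ofⁿ A≮D = remFuel-small k (A +ₚ Dₘ) (normal-norm (A ⊕ Dₘ)) mD shorter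
  where
  Dₘ : Poly
  Dₘ = replicate (length A ∸ length D) false ++ D
  D≤A : length D ≤ length A
  D≤A = ≮⇒≥ A≮D
  length-Dₘ : length Dₘ ≡ length A
  length-Dₘ = begin
    length Dₘ                                          ≡⟨ length-++ (replicate (length A ∸ length D) false) ⟩
    length (replicate (length A ∸ length D) false) + length D ≡⟨ cong (_+ length D) (length-replicate (length A ∸ length D)) ⟩
    length A ∸ length D + length D                     ≡⟨ m∸n+n≡m D≤A ⟩
    length A                                           ∎
    where open ≡-Reasoning
  mA : Monic A
  mA = normal-nonempty nA (≤-trans (monic-length-pos mD) D≤A)
  shorter : len (A ⊕ Dₘ) ≤ k
  shorter = ≤-pred (≤-trans (⊕-top-cancel mA (monic-shift _ mD) (sym length-Dₘ)) A≤k)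

rem-small : ∀ A {D} → Monic D → Normal (rem A D) × length (rem A D) < length D
rem-small A mD rewrite norm-normal (monic mD) = remFuel-small (len A) (norm A) (normal-norm A) mD ≤-refl

rem-normal : ∀ A {D} → Monic D → Normal (rem A D)
rem-normal A mD = proj₁ (rem-small A mD)

len-rem : ∀ A {D} → Monic D → len (rem A D) < length D
len-rem A {D} mD = subst (_< length D) (sym (len-normal (rem-normal A mD))) (proj₂ (rem-small A mD))

∣-⊕-rem : ∀ A {D} → Monic D → D ∣ A ⊕ rem A D
∣-⊕-rem A {D} mD rewrite norm-normal (monic mD) =
  ∣-respʳ (⊕-cong (norm-≈ A) ≈-refl) (∣-⊕-remFuel (len A) (norm A) D)

∣-shorter⇒≈[] : ∀ {D R} → Monic D → D ∣ R → len R < length D → R ≈ []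
∣-shorter⇒≈[] {R = R} mD D∣R R<D with ≈[]? R
... | yes R≈0 = R≈0
... | no R≉0 = ⊥-elim (<⇒≱ R<D (∣-len mD D∣R R≉0))

rem≡[]⇒∣ : ∀ A {D} → Monic D → rem A D ≡ [] → D ∣ A
rem≡[]⇒∣ A mD r≡0 = ∣-respʳ (≈-trans (⊕-cong ≈-refl (≡⇒≈ r≡0)) (⊕-identityʳ A)) (∣-⊕-rem A mD)

∣⇒rem≡[] : ∀ A {D} → Monic D → D ∣ A → rem A D ≡ []
∣⇒rem≡[] A {D} mD D∣A = normal-unique (rem-normal A mD) nil (∣-shorter⇒≈[] mD D∣R (len-rem A mD))
  where
  D∣R : D ∣ rem A D
  D∣R = ∣-respʳ (⊕-cancel A (rem A D)) (∣-⊕ D∣A (∣-⊕-rem A mD))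

-- Euclid's lemma and the divisors of S ^ m

record Bézout (A B : Poly) : Set where
  field
    gcd u v : Poly
    gcd∣A : gcd ∣ A
    gcd∣B : gcd ∣ B
    identity : u ⊗ A ⊕ v ⊗ B ≈ gcd

bézout : ∀ n A B → len B ≤ n → Bézout A B
bézout n A B B≤n with ≈[]? B
... | yes B≈0 = record
  { gcd = A ; u = 1ₚ ; v = []
  ; gcd∣A = ∣-refl ; gcd∣B = [] , ≈-sym B≈0
  ; identity = ≈-trans (⊕-identityʳ (1ₚ ⊗ A)) (⊗-identityˡ A)
  }
bézout zero A B B≤0 | no B≉0 = ⊥-elim (<⇒≱ (len-pos B≉0) B≤0)
bézout (suc n) A B B≤n | no B≉0 = record
  { gcd = gcd ; u = v ; v = u ⊕ v ⊗ Q
  ; gcd∣A = ∣-respʳ R+QB′≈A (∣-⊕ gcd∣R (∣-⊗ˡ Q gcd∣B′))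
  ; gcd∣B = ∣-respʳ (norm-≈ B) gcd∣B′
  ; identity = begin
      v ⊗ A ⊕ (u ⊕ v ⊗ Q) ⊗ B     ≈⟨ ⊕-cong (≈-refl {v ⊗ A}) (⊗-congʳ (u ⊕ v ⊗ Q) (norm-≈ B)) ⟨
      v ⊗ A ⊕ (u ⊕ v ⊗ Q) ⊗ B′    ≈⟨ recombine A B′ Q u v ⟩
      u ⊗ B′ ⊕ v ⊗ (A ⊕ Q ⊗ B′)   ≈⟨ ⊕-cong (≈-refl {u ⊗ B′}) (⊗-congʳ v A+QB′≈R) ⟩
      u ⊗ B′ ⊕ v ⊗ R              ≈⟨ identity′ ⟩
      gcd                          ∎
  }
  where
  open ≈-Reasoning
  B′ R : Poly
  B′ = norm B
  R = rem A B′
  mB′ : Monic B′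
  mB′ = monic-norm B≉0
  len-R≤n : len R ≤ n
  len-R≤n = ≤-pred (≤-trans (len-rem A mB′) B≤n)
  Q : Poly
  Q = proj₁ (∣-⊕-rem A mB′)
  QB′≈A+R : Q ⊗ B′ ≈ A ⊕ R
  QB′≈A+R = proj₂ (∣-⊕-rem A mB′)
  A+QB′≈R : A ⊕ Q ⊗ B′ ≈ R
  A+QB′≈R = ≈-trans (⊕-cong (≈-refl {A}) QB′≈A+R) (⊕-cancel A R)
  R+QB′≈A : R ⊕ Q ⊗ B′ ≈ A
  R+QB′≈A = ≈-trans (⊕-cong (≈-refl {R}) (≈-trans QB′≈A+R (⊕-comm A R))) (⊕-cancel R A)
  open Bézout (bézout n B′ R len-R≤n) renaming (gcd∣A to gcd∣B′; gcd∣B to gcd∣R; identity to identity′)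
  recombine : ∀ a b q u v → v ⊗ a ⊕ (u ⊕ v ⊗ q) ⊗ b ≈ u ⊗ b ⊕ v ⊗ (a ⊕ q ⊗ b)
  recombine = solve-∀ ring

Irreducible : Poly → Set
Irreducible S = ∀ {G} → Monic G → G ∣ S → G ≡ 1ₚ ⊎ G ≡ S

∣-nonzero : ∀ {D A} → D ∣ A → Nonzero A → Nonzero D
∣-nonzero (Q , e) A≉0 D≈0 = A≉0 (≈-trans (≈-sym e) (≈-trans (⊗-congʳ Q D≈0) (⊗-zeroʳ Q)))

euclid : ∀ {S} → Monic S → Irreducible S → ∀ D E → S ∣ D ⊗ E → S ∣ D ⊎ S ∣ E
euclid {S} mS irr D E S∣DE = by-cases (irr (monic-norm G≉0) (∣-respˡ (≈-sym (norm-≈ gcd)) gcd∣B))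
  where
  open Bézout (bézout (len S) D S ≤-refl)
  G≉0 : Nonzero gcd
  G≉0 = ∣-nonzero gcd∣B (monic-≉[] mS)
  regroup : ∀ u d e v s → u ⊗ (d ⊗ e) ⊕ (v ⊗ e) ⊗ s ≈ (u ⊗ d ⊕ v ⊗ s) ⊗ e
  regroup = solve-∀ ring
  by-cases : norm gcd ≡ 1ₚ ⊎ norm gcd ≡ S → S ∣ D ⊎ S ∣ E
  by-cases (inj₂ G≡S) = inj₁ (∣-respˡ (≈-trans (≈-sym (norm-≈ gcd)) (≡⇒≈ G≡S)) gcd∣A)
  by-cases (inj₁ G≡1) = inj₂ (∣-respʳ E≈ (∣-⊕ (∣-⊗ˡ u S∣DE) (∣-⊗ˡ (v ⊗ E) ∣-refl)))
    where
    open ≈-Reasoning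
    E≈ : u ⊗ (D ⊗ E) ⊕ (v ⊗ E) ⊗ S ≈ E
    E≈ = begin
      u ⊗ (D ⊗ E) ⊕ (v ⊗ E) ⊗ S  ≈⟨ regroup u D E v S ⟩
      (u ⊗ D ⊕ v ⊗ S) ⊗ E        ≈⟨ ⊗-congˡ E (≈-trans identity (≈-trans (≈-sym (norm-≈ gcd)) (≡⇒≈ G≡1))) ⟩
      1ₚ ⊗ E                      ≈⟨ ⊗-identityˡ E ⟩
      E                           ∎

^-suc : ∀ S m → S ^ₚ suc m ≈ S ⊗ S ^ₚ m
^-suc S m = norm-≈ (S ⊗ S ^ₚ m)

monic-^ : ∀ {S} → Monic S → ∀ m → Monic (S ^ₚ m)
monic-^ mS zero = one
monic-^ mS (suc m) = monic-norm (⊗-nonzero (monic-≉[] mS) (monic-≉[] (monic-^ mS m)))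

^-+ : ∀ S a b → S ^ₚ a ⊗ S ^ₚ b ≈ S ^ₚ (a + b)
^-+ S zero b = ⊗-identityˡ (S ^ₚ b)
^-+ S (suc a) b = begin
  S ^ₚ suc a ⊗ S ^ₚ b        ≈⟨ ⊗-congˡ (S ^ₚ b) (^-suc S a) ⟩
  (S ⊗ S ^ₚ a) ⊗ S ^ₚ b      ≈⟨ ⊗-assoc S (S ^ₚ a) (S ^ₚ b) ⟩
  S ⊗ (S ^ₚ a ⊗ S ^ₚ b)      ≈⟨ ⊗-congʳ S (^-+ S a b) ⟩
  S ⊗ S ^ₚ (a + b)           ≈⟨ ^-suc S (a + b) ⟨
  S ^ₚ suc (a + b)           ∎
  where open ≈-Reasoning

^-∣-^ : ∀ S {j m} → j ≤ m → S ^ₚ j ∣ S ^ₚ m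
^-∣-^ S {j} {m} j≤m = S ^ₚ (m ∸ j) , ≈-trans (^-+ S (m ∸ j) j) (≡⇒≈ (cong (S ^ₚ_) (m∸n+n≡m j≤m)))

length-^ : ∀ {S δ} → Monic S → length S ≡ suc δ → ∀ j → length (S ^ₚ j) ≡ suc (j * δ)
length-^ mS S≡1+δ zero = refl
length-^ {S} {δ} mS S≡1+δ (suc j) = suc-injective (begin
  suc (len (S ⊗ S ^ₚ j))        ≡⟨ len-⊗ (monic-≉[] mS) (monic-≉[] (monic-^ mS j)) ⟩
  len S + len (S ^ₚ j)          ≡⟨ cong₂ _+_ (trans (len-monic mS) S≡1+δ) (trans (len-monic (monic-^ mS j)) (length-^ mS S≡1+δ j)) ⟩
  suc δ + suc (j * δ)           ≡⟨ cong suc (+-suc δ (j * δ)) ⟩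
  suc (suc (suc j * δ))         ∎)
  where open ≡-Reasoning

monic-∣-1 : ∀ {D} → Monic D → D ∣ 1ₚ → D ≡ 1ₚ
monic-∣-1 one _ = refl
monic-∣-1 (cons b m) D∣1 with ∣-len (cons b m) D∣1 (monic-≉[] one)
... | s≤s ()

∣-^-suc : ∀ {S} → Monic S → Irreducible S → ∀ m {D} → Monic D → D ∣ S ^ₚ suc m →
  D ∣ S ^ₚ m ⊎ Σ Poly λ D′ → Monic D′ × D ≈ S ⊗ D′ × D′ ∣ S ^ₚ m
∣-^-suc {S} mS irr m {D} mD (Q , QD≈Sᵐ⁺¹) with euclid mS irr Q D (S ^ₚ m , Sᵐ⁺¹≈QD)
  where
  Sᵐ⁺¹≈QD : S ^ₚ m ⊗ S ≈ Q ⊗ D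
  Sᵐ⁺¹≈QD = ≈-trans (⊗-comm (S ^ₚ m) S) (≈-sym (≈-trans QD≈Sᵐ⁺¹ (^-suc S m)))
... | inj₁ S∣Q = inj₁ (∣-cancelˡ (monic-≉[] mS) (∣-respʳ QD≈SSᵐ (∣-⊗ʳ D S∣Q)))
  where
  QD≈SSᵐ : Q ⊗ D ≈ S ⊗ S ^ₚ m
  QD≈SSᵐ = ≈-trans QD≈Sᵐ⁺¹ (^-suc S m)
... | inj₂ (D′ , D′S≈D) = inj₂ (norm D′ , monic-norm D′≉0 , ≈-trans D≈SD′ (⊗-congʳ S (≈-sym (norm-≈ D′))) ,
        ∣-respˡ (≈-sym (norm-≈ D′)) (∣-cancelˡ (monic-≉[] mS) (∣-respˡ D≈SD′ (Q , QD≈SSᵐ))))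
  where
  QD≈SSᵐ : Q ⊗ D ≈ S ⊗ S ^ₚ m
  QD≈SSᵐ = ≈-trans QD≈Sᵐ⁺¹ (^-suc S m)
  D≈SD′ : D ≈ S ⊗ D′
  D≈SD′ = ≈-trans (≈-sym D′S≈D) (⊗-comm D′ S)
  D′≉0 : Nonzero D′
  D′≉0 D′≈0 = monic-≉[] mD (≈-trans D≈SD′ (≈-trans (⊗-congʳ S D′≈0) (⊗-zeroʳ S)))

∣-^-irreducible : ∀ {S} → Monic S → Irreducible S → ∀ m {D} → Monic D → D ∣ S ^ₚ m → Σ ℕ λ j → j ≤ m × D ≡ S ^ₚ j
∣-^-irreducible mS irr zero mD D∣1 = 0 , z≤n , monic-∣-1 mD D∣1
∣-^-irreducible {S} mS irr (suc m) {D} mD D∣Sᵐ⁺¹ with ∣-^-suc mS irr m mD D∣Sᵐ⁺¹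
... | inj₁ D∣Sᵐ with ∣-^-irreducible mS irr m mD D∣Sᵐ
...   | j , j≤m , D≡Sʲ = j , ≤-trans j≤m (n≤1+n m) , D≡Sʲ
∣-^-irreducible {S} mS irr (suc m) {D} mD D∣Sᵐ⁺¹ | inj₂ (D′ , mD′ , D≈SD′ , D′∣Sᵐ)
  with ∣-^-irreducible mS irr m mD′ D′∣Sᵐ
... | j , j≤m , refl = suc j , s≤s j≤m , monic-unique mD (monic-^ mS (suc j)) (≈-trans D≈SD′ (≈-sym (^-suc S j)))

-- Irreducibility by trial division

monic-length-1 : ∀ {p} → Monic p → length p ≡ 1 → p ≡ 1ₚ
monic-length-1 one _ = refl
monic-length-1 (cons b m) ()

monic-snoc : ∀ {D} → Monic D → Σ (List Bool) λ l → D ≡ l ++ true ∷ []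
monic-snoc one = [] , refl
monic-snoc (cons b m) with monic-snoc m
... | l , e = b ∷ l , cong (b ∷_) e

length-snoc : ∀ l → length (l ++ true ∷ []) ≡ suc (length l)
length-snoc l = trans (length-++ l) (+-comm (length l) 1)

++-true-monic : ∀ l → Monic (l ++ true ∷ [])
++-true-monic [] = one
++-true-monic (b ∷ l) = monic-∷ b (++-true-monic l)

∈-allBits : ∀ l → l ∈ allBits (length l)
∈-allBits [] = here refl
∈-allBits (false ∷ l) = ∈-concat⁺′ (here refl) (∈-map⁺ _ (∈-allBits l))
∈-allBits (true ∷ l) = ∈-concat⁺′ (there (here refl)) (∈-map⁺ _ (∈-allBits l))

∈-monicsOfDeg : ∀ l → l ++ true ∷ [] ∈ monicsOfDeg (length l)
∈-monicsOfDeg l = ∈-concat⁺′ (here refl) (∈-map⁺ _ (∈-allBits l))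

NoFactorOfDegree : Poly → ℕ → Set
NoFactorOfDegree S d = All (λ D → rem S D ≢ []) (monicsOfDeg d)

noFactorOfDegree? : ∀ S d → Dec (NoFactorOfDegree S d)
noFactorOfDegree? S d = all? (λ D → ¬? (≡-dec Bool._≟_ (rem S D) [])) (monicsOfDeg d)

monic-∣-equal-length : ∀ {G S} → Monic G → Monic S → G ∣ S → length G ≡ length S → G ≡ S
monic-∣-equal-length {G} {S} mG mS (Q , QG≈S) G≡S = monic-unique mG mS G≈S
  where
  Q≉0 : Nonzero Q
  Q≉0 Q≈0 = monic-≉[] mS (≈-trans (≈-sym QG≈S) (⊗-zeroˡ G Q≈0))
  len-Q≡1 : len Q ≡ 1
  len-Q≡1 = +-cancelʳ-≡ (len G) (len Q) 1 (begin
    len Q + len G          ≡⟨ len-⊗ Q≉0 (monic-≉[] mG) ⟨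
    suc (len (Q ⊗ G))      ≡⟨ cong suc (trans (len-cong QG≈S) (len-monic mS)) ⟩
    suc (length S)         ≡⟨ cong suc (trans (sym G≡S) (sym (len-monic mG))) ⟩
    1 + len G              ∎)
    where open ≡-Reasoning
  G≈S : G ≈ S
  G≈S = begin
    G        ≈⟨ ⊗-identityˡ G ⟨
    1ₚ ⊗ G   ≈⟨ ⊗-congˡ G (≈-trans (≡⇒≈ (sym (monic-length-1 (monic-norm Q≉0) len-Q≡1))) (norm-≈ Q)) ⟩
    Q ⊗ G    ≈⟨ QG≈S ⟩
    S        ∎
    where open ≈-Reasoning

irreducible-by-trial-division : ∀ {S δ} → Monic S → length S ≡ suc (suc δ) →
  All (λ d → NoFactorOfDegree S (suc d)) (upTo δ) → Irreducible S
irreducible-by-trial-division {S} {δ} mS S≡2+δ checked {G} mG G∣S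
  with length G ≟ 1 | length G ≟ length S
... | yes G≡1 | _ = inj₁ (monic-length-1 mG G≡1)
... | no _ | yes G≡S = inj₂ (monic-∣-equal-length mG mS G∣S G≡S)
... | no G≢1 | no G≢S with monic-snoc mG
... | [] , refl = ⊥-elim (G≢1 refl)
... | b ∷ l , refl = ⊥-elim (rem≢[] (∣⇒rem≡[] S mG G∣S))
  where
  G<S : suc (suc (length l)) < suc (suc δ)
  G<S = subst₂ _<_ (cong suc (length-snoc l)) S≡2+δ
    (≤∧≢⇒< (subst (length (b ∷ l ++ true ∷ []) ≤_) (len-monic mS) (∣-len mG G∣S (monic-≉[] mS))) G≢S)
  rem≢[] : rem S (b ∷ l ++ true ∷ []) ≢ []
  rem≢[] = lookup (lookup checked (∈-upTo⁺ (≤-pred (≤-pred G<S)))) (∈-monicsOfDeg (b ∷ l))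

-- Divisor sums

∑ : {A : Set} → List A → (A → Poly) → Poly
∑ xs f = foldr (λ x s → f x ⊕ s) [] xs

∑-cong : {A : Set} {f g : A → Poly} (xs : List A) → (∀ x → f x ≈ g x) → ∑ xs f ≈ ∑ xs g
∑-cong [] h = ≈-refl
∑-cong (x ∷ xs) h = ⊕-cong (h x) (∑-cong xs h)

∑-++ : {A : Set} (xs ys : List A) (f : A → Poly) → ∑ (xs ++ ys) f ≈ ∑ xs f ⊕ ∑ ys f
∑-++ [] ys f = ≈-refl
∑-++ (x ∷ xs) ys f = ≈-trans (⊕-cong (≈-refl {f x}) (∑-++ xs ys f)) (≈-sym (⊕-assoc (f x) (∑ xs f) (∑ ys f)))

∑-concatMap : {A B : Set} (g : A → List B) (xs : List A) (f : B → Poly) →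
  ∑ (concatMap g xs) f ≈ ∑ xs (λ x → ∑ (g x) f)
∑-concatMap g [] f = ≈-refl
∑-concatMap g (x ∷ xs) f = ≈-trans (∑-++ (g x) (concatMap g xs) f) (⊕-cong (≈-refl {∑ (g x) f}) (∑-concatMap g xs f))

∑-filter : {A : Set} (p : A → Bool) (xs : List A) (f : A → Poly) →
  ∑ (filterᵇ p xs) f ≡ ∑ xs (λ x → if p x then f x else [])
∑-filter p [] f = refl
∑-filter p (x ∷ xs) f with p x
... | true = cong (f x ⊕_) (∑-filter p xs f)
... | false = ∑-filter p xs f

∑-upTo-suc : ∀ n (f : ℕ → Poly) → ∑ (upTo (suc n)) f ≈ ∑ (upTo n) f ⊕ f n
∑-upTo-suc n f = begin
  ∑ (upTo (suc n)) f          ≡⟨ cong (λ xs → ∑ xs f) (upTo-∷ʳ n) ⟨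
  ∑ (upTo n ++ n ∷ []) f      ≈⟨ ∑-++ (upTo n) (n ∷ []) f ⟩
  ∑ (upTo n) f ⊕ (f n ⊕ [])   ≈⟨ ⊕-cong (≈-refl {∑ (upTo n) f}) (⊕-identityʳ (f n)) ⟩
  ∑ (upTo n) f ⊕ f n          ∎
  where open ≈-Reasoning

∑-allBits-suc : ∀ d (f : List Bool → Poly) →
  ∑ (allBits (suc d)) f ≈ ∑ (allBits d) (λ l → f (false ∷ l) ⊕ (f (true ∷ l) ⊕ []))
∑-allBits-suc d f = ∑-concatMap (λ l → (false ∷ l) ∷ (true ∷ l) ∷ []) (allBits d) f

∑-allBits-zero : ∀ d (f : List Bool → Poly) → (∀ l → length l ≡ d → f l ≈ []) → ∑ (allBits d) f ≈ []
∑-allBits-zero zero f vanish = ⊕-cong (vanish [] refl) (≈-refl {[]})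
∑-allBits-zero (suc d) f vanish = ≈-trans (∑-allBits-suc d f) (∑-allBits-zero d _ λ l l≡d →
  ⊕-cong (vanish (false ∷ l) (cong suc l≡d)) (⊕-cong (vanish (true ∷ l) (cong suc l≡d)) (≈-refl {[]})))

∑-allBits-single : ∀ d (f : List Bool → Poly) l₀ → length l₀ ≡ d →
  (∀ l → length l ≡ d → l ≢ l₀ → f l ≈ []) → ∑ (allBits d) f ≈ f l₀
∑-allBits-single zero f [] _ vanish = ⊕-identityʳ (f [])
∑-allBits-single (suc d) f (b ∷ l₀) l₀≡d vanish =
  ≈-trans (∑-allBits-suc d f) (≈-trans (∑-allBits-single d _ l₀ (suc-injective l₀≡d) vanish′) (pick b refl))
  where
  other : ∀ {l} b′ → length l ≡ d → l ≢ l₀ → f (b′ ∷ l) ≈ []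
  other b′ l≡d l≢l₀ = vanish (b′ ∷ _) (cong suc l≡d) λ { refl → l≢l₀ refl }
  vanish′ : ∀ l → length l ≡ d → l ≢ l₀ → f (false ∷ l) ⊕ (f (true ∷ l) ⊕ []) ≈ []
  vanish′ l l≡d l≢l₀ = ⊕-cong (other false l≡d l≢l₀) (⊕-cong (other true l≡d l≢l₀) (≈-refl {[]}))
  pick : ∀ b′ → b′ ≡ b → f (false ∷ l₀) ⊕ (f (true ∷ l₀) ⊕ []) ≈ f (b′ ∷ l₀)
  pick false refl =
    ≈-trans (⊕-cong (≈-refl {f (false ∷ l₀)}) (⊕-cong (vanish (true ∷ l₀) l₀≡d λ ()) (≈-refl {[]}))) (⊕-identityʳ _)
  pick true refl = ⊕-cong (vanish (false ∷ l₀) l₀≡d λ ()) (⊕-identityʳ _)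

multiples-gap : ∀ m j k → k < m → ∀ i → i * suc m ≢ j * suc m + suc k
multiples-gap m j k k<m i eq with i ≤? j
... | yes i≤j = <⇒≱ (m<m+n (j * suc m) z<s) (≤-trans (≤-reflexive (sym eq)) (*-monoˡ-≤ (suc m) i≤j))
... | no i≰j = <-irrefl refl (begin-strict
  j * suc m + suc k   <⟨ +-monoʳ-< (j * suc m) (s≤s k<m) ⟩
  j * suc m + suc m   ≡⟨ +-comm (j * suc m) (suc m) ⟩
  suc j * suc m       ≤⟨ *-monoˡ-≤ (suc m) (≰⇒> i≰j) ⟩
  i * suc m           ≡⟨ eq ⟩
  j * suc m + suc k   ∎)
  where open ≤-Reasoning

∑-upTo-multiples : ∀ m N (f u : ℕ → Poly) →
  (∀ j → j ≤ N → f (j * suc m) ≈ u j) →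
  (∀ d → (∀ j → j ≤ N → j * suc m ≢ d) → f d ≈ []) →
  ∑ (upTo (suc (N * suc m))) f ≈ ∑ (upTo (suc N)) u
∑-upTo-multiples m N f u on off = prefix N ≤-refl
  where
  gap : ∀ j k → k ≤ m → ∑ (upTo (suc (j * suc m + k))) f ≈ ∑ (upTo (suc (j * suc m))) f
  gap j zero _ = ≡⇒≈ (cong (λ n → ∑ (upTo (suc n)) f) (+-identityʳ (j * suc m)))
  gap j (suc k) k<m = begin
    ∑ (upTo (suc (j * suc m + suc k))) f              ≈⟨ ∑-upTo-suc (j * suc m + suc k) f ⟩
    ∑ (upTo (j * suc m + suc k)) f ⊕ f (j * suc m + suc k)
        ≈⟨ ⊕-cong (≡⇒≈ (cong (λ n → ∑ (upTo n) f) (+-suc (j * suc m) k))) (off _ (λ i _ → multiples-gap m j k k<m i)) ⟩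
    ∑ (upTo (suc (j * suc m + k))) f ⊕ []             ≈⟨ ⊕-identityʳ _ ⟩
    ∑ (upTo (suc (j * suc m + k))) f                  ≈⟨ gap j k (≤-trans (n≤1+n k) k<m) ⟩
    ∑ (upTo (suc (j * suc m))) f                      ∎
    where open ≈-Reasoning
  prefix : ∀ j → j ≤ N → ∑ (upTo (suc (j * suc m))) f ≈ ∑ (upTo (suc j)) u
  prefix zero _ = ⊕-cong (on 0 z≤n) (≈-refl {[]})
  prefix (suc j) j<N = begin
    ∑ (upTo (suc (suc j * suc m))) f                  ≈⟨ ∑-upTo-suc (suc j * suc m) f ⟩
    ∑ (upTo (suc j * suc m)) f ⊕ f (suc j * suc m)
        ≡⟨ cong (λ n → ∑ (upTo n) f ⊕ f (suc j * suc m)) (cong suc (+-comm m (j * suc m))) ⟩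
    ∑ (upTo (suc (j * suc m + m))) f ⊕ f (suc j * suc m)
        ≈⟨ ⊕-cong (gap j m ≤-refl) (on (suc j) j<N) ⟩
    ∑ (upTo (suc (j * suc m))) f ⊕ u (suc j)          ≈⟨ ⊕-cong (prefix j (≤-trans (n≤1+n j) j<N)) (≈-refl {u (suc j)}) ⟩
    ∑ (upTo (suc j)) u ⊕ u (suc j)                    ≈⟨ ∑-upTo-suc (suc j) u ⟨
    ∑ (upTo (suc (suc j))) u                          ∎
    where open ≈-Reasoning

foldr-+ₚ : ∀ xs → foldr _+ₚ_ [] xs ≈ ∑ xs (λ D → D)
foldr-+ₚ [] = ≈-refl
foldr-+ₚ (x ∷ xs) = ≈-trans (norm-≈ (x ⊕ foldr _+ₚ_ [] xs)) (⊕-cong (≈-refl {x}) (foldr-+ₚ xs))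

divisorTerm : Poly → Poly → Poly
divisorTerm A D = if null (rem A D) then D else []

divisorSumOfDegree : Poly → ℕ → Poly
divisorSumOfDegree A d = ∑ (allBits d) (λ l → divisorTerm A (l ++ true ∷ []))

σ-by-degree : ∀ A → σ A ≈ ∑ (upTo (len A)) (divisorSumOfDegree A)
σ-by-degree A = begin
  σ A                                                              ≈⟨ foldr-+ₚ (monicDivisors A) ⟩
  ∑ (monicDivisors A) (λ D → D)                                   ≡⟨ ∑-filter (λ D → null (rem A D)) (monicCandidates A) (λ D → D) ⟩
  ∑ (monicCandidates A) (divisorTerm A)                           ≈⟨ ∑-concatMap monicsOfDeg (upTo (len A)) (divisorTerm A) ⟩
  ∑ (upTo (len A)) (λ d → ∑ (monicsOfDeg d) (divisorTerm A))
      ≈⟨ ∑-cong (upTo (len A)) (λ d → ∑-concatMap (λ l → (l ++ true ∷ []) ∷ []) (allBits d) (divisorTerm A)) ⟩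
  ∑ (upTo (len A)) (λ d → ∑ (allBits d) (λ l → divisorTerm A (l ++ true ∷ []) ⊕ []))
      ≈⟨ ∑-cong (upTo (len A)) (λ d → ∑-cong (allBits d) (λ l → ⊕-identityʳ (divisorTerm A (l ++ true ∷ [])))) ⟩
  ∑ (upTo (len A)) (divisorSumOfDegree A)                         ∎
  where open ≈-Reasoning

module _ {S δ} (mS : Monic S) (S≡2+δ : length S ≡ suc (suc δ)) (irr : Irreducible S) (N : ℕ) where

  private
    A : Poly
    A = S ^ₚ N

  degree-of-power : ∀ i l → l ++ true ∷ [] ≡ S ^ₚ i → i * suc δ ≡ length l
  degree-of-power i l e = suc-injective (begin
    suc (i * suc δ)             ≡⟨ length-^ mS S≡2+δ i ⟨
    length (S ^ₚ i)             ≡⟨ cong length e ⟨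
    length (l ++ true ∷ [])     ≡⟨ length-snoc l ⟩
    suc (length l)              ∎)
    where open ≡-Reasoning

  divisorTerm-non-power : ∀ l → (∀ i → i ≤ N → l ++ true ∷ [] ≢ S ^ₚ i) → divisorTerm A (l ++ true ∷ []) ≈ []
  divisorTerm-non-power l not-power with rem A (l ++ true ∷ []) in r≡[]
  ... | _ ∷ _ = ≈-refl
  ... | [] with ∣-^-irreducible mS irr N (++-true-monic l) (rem≡[]⇒∣ A (++-true-monic l) r≡[])
  ...   | i , i≤N , l∷1≡Sⁱ = ⊥-elim (not-power i i≤N l∷1≡Sⁱ)

  layer-multiple : ∀ j → j ≤ N → divisorSumOfDegree A (j * suc δ) ≈ S ^ₚ j
  layer-multiple j j≤N with monic-snoc (monic-^ mS j)
  ... | l₀ , Sʲ≡l₀∷1 = ≈-trans (∑-allBits-single (j * suc δ) (λ l → divisorTerm A (l ++ true ∷ [])) l₀ l₀≡jδ others) at-l₀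
    where
    l₀≡jδ : length l₀ ≡ j * suc δ
    l₀≡jδ = sym (degree-of-power j l₀ (sym Sʲ≡l₀∷1))
    at-l₀ : divisorTerm A (l₀ ++ true ∷ []) ≈ S ^ₚ j
    at-l₀ rewrite sym Sʲ≡l₀∷1 | ∣⇒rem≡[] A (monic-^ mS j) (^-∣-^ S j≤N) = ≈-refl
    others : ∀ l → length l ≡ j * suc δ → l ≢ l₀ → divisorTerm A (l ++ true ∷ []) ≈ []
    others l l≡jδ l≢l₀ = divisorTerm-non-power l λ i _ l∷1≡Sⁱ → l≢l₀ (++-cancelʳ (true ∷ []) l l₀ (begin
      l ++ true ∷ []    ≡⟨ l∷1≡Sⁱ ⟩
      S ^ₚ i            ≡⟨ cong (S ^ₚ_) (*-cancelʳ-≡ i j (suc δ) (trans (degree-of-power i l l∷1≡Sⁱ) l≡jδ)) ⟩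
      S ^ₚ j            ≡⟨ Sʲ≡l₀∷1 ⟩
      l₀ ++ true ∷ []   ∎))
      where open ≡-Reasoning

  layer-other : ∀ d → (∀ j → j ≤ N → j * suc δ ≢ d) → divisorSumOfDegree A d ≈ []
  layer-other d not-multiple = ∑-allBits-zero d (λ l → divisorTerm A (l ++ true ∷ [])) λ l l≡d →
    divisorTerm-non-power l λ i i≤N l∷1≡Sⁱ → not-multiple i i≤N (trans (degree-of-power i l l∷1≡Sⁱ) l≡d)

  σ-power : σ (S ^ₚ N) ≈ ∑ (upTo (suc N)) (S ^ₚ_)
  σ-power = begin
    σ A                                                                 ≈⟨ σ-by-degree A ⟩
    ∑ (upTo (len A)) (divisorSumOfDegree A)
        ≡⟨ cong (λ n → ∑ (upTo n) (divisorSumOfDegree A)) (trans (len-monic (monic-^ mS N)) (length-^ mS S≡2+δ N)) ⟩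
    ∑ (upTo (suc (N * suc δ))) (divisorSumOfDegree A)
        ≈⟨ ∑-upTo-multiples δ N (divisorSumOfDegree A) (S ^ₚ_) layer-multiple layer-other ⟩
    ∑ (upTo (suc N)) (S ^ₚ_)                                           ∎
    where open ≈-Reasoning

∑-∣-cong : ∀ {D} {A : Set} (xs : List A) (f g : A → Poly) → (∀ x → D ∣ f x ⊕ g x) → D ∣ ∑ xs f ⊕ ∑ xs g
∑-∣-cong [] f g _ = [] , ≈-sym (⊕-identityʳ [])
∑-∣-cong (x ∷ xs) f g D∣f+g = ∣-respʳ (⊕-interchange (f x) (g x) (∑ xs f) (∑ xs g)) (∣-⊕ (D∣f+g x) (∑-∣-cong xs f g D∣f+g))

∣-^-⊕-1 : ∀ {D S} → D ∣ S ⊕ 1ₚ → ∀ j → D ∣ S ^ₚ j ⊕ 1ₚ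
∣-^-⊕-1 D∣S+1 zero = [] , ≈-sym (⊕-inverse 1ₚ)
∣-^-⊕-1 {D} {S} D∣S+1 (suc j) = ∣-respʳ step (∣-⊕ (∣-⊗ˡ S (∣-^-⊕-1 D∣S+1 j)) D∣S+1)
  where
  step : S ⊗ (S ^ₚ j ⊕ 1ₚ) ⊕ (S ⊕ 1ₚ) ≈ S ^ₚ suc j ⊕ 1ₚ
  step = begin
    S ⊗ (S ^ₚ j ⊕ 1ₚ) ⊕ (S ⊕ 1ₚ)    ≈⟨ expand S (S ^ₚ j) ⟩
    S ⊗ S ^ₚ j ⊕ (S ⊕ (S ⊕ 1ₚ))     ≈⟨ ⊕-cong (≈-sym (^-suc S j)) (⊕-cancel S 1ₚ) ⟩
    S ^ₚ suc j ⊕ 1ₚ                  ∎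
    where
    open ≈-Reasoning
    expand : ∀ s p → s ⊗ (p ⊕ 1ₚ) ⊕ (s ⊕ 1ₚ) ≈ s ⊗ p ⊕ (s ⊕ (s ⊕ 1ₚ))
    expand = solve-∀ ring

∑-upTo-const-odd : ∀ k p → ∑ (upTo (suc (2 * k))) (λ _ → p) ≈ p
∑-upTo-const-odd zero p = ⊕-identityʳ p
∑-upTo-const-odd (suc k) p = begin
  ∑ (upTo (suc (2 * suc k))) (λ _ → p)         ≡⟨ cong (λ n → ∑ (upTo (suc n)) (λ _ → p)) (*-suc 2 k) ⟩
  ∑ (upTo (suc (suc (suc (2 * k))))) (λ _ → p) ≈⟨ ∑-upTo-suc (suc (suc (2 * k))) (λ _ → p) ⟩
  ∑ (upTo (suc (suc (2 * k)))) (λ _ → p) ⊕ p   ≈⟨ ⊕-cong (∑-upTo-suc (suc (2 * k)) (λ _ → p)) (≈-refl {p}) ⟩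
  (∑ (upTo (suc (2 * k))) (λ _ → p) ⊕ p) ⊕ p   ≈⟨ ⊕-assoc _ p p ⟩
  ∑ (upTo (suc (2 * k))) (λ _ → p) ⊕ (p ⊕ p)   ≈⟨ ⊕-cong (∑-upTo-const-odd k p) (⊕-inverse p) ⟩
  p ⊕ []                                       ≈⟨ ⊕-identityʳ p ⟩
  p                                            ∎
  where open ≈-Reasoning

σ-even-power-not-divisible : ∀ {S δ D} → Monic S → length S ≡ suc (suc δ) → Irreducible S →
  Monic D → D ≢ 1ₚ → D ∣ S ⊕ 1ₚ → ∀ k → ¬ (D ∣ σ (S ^ₚ (2 * k)))
σ-even-power-not-divisible {S} {δ} {D} mS S≡2+δ irr mD D≢1 D∣S+1 k D∣σ = D≢1 (monic-∣-1 mD D∣1)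
  where
  n : ℕ
  n = suc (2 * k)
  D∣∑Sʲ : D ∣ ∑ (upTo n) (S ^ₚ_)
  D∣∑Sʲ = ∣-respʳ (σ-power mS S≡2+δ irr (2 * k)) D∣σ
  D∣1 : D ∣ 1ₚ
  D∣1 = ∣-respʳ (≈-trans (⊕-cancel (∑ (upTo n) (S ^ₚ_)) (∑ (upTo n) (λ _ → 1ₚ))) (∑-upTo-const-odd k 1ₚ))
          (∣-⊕ D∣∑Sʲ (∑-∣-cong (upTo n) (S ^ₚ_) (λ _ → 1ₚ) (∣-^-⊕-1 D∣S+1)))

-- The polynomials S₁, …, S₁₅

∣ₚ⇒∣ : ∀ {D A} → D ∣ₚ A → D ∣ A
∣ₚ⇒∣ {D} {A} (Q , QD≡A) = Q , ≈-trans (≈-sym (norm-≈ (Q ⊗ D))) (≈-trans (≡⇒≈ QD≡A) (norm-≈ A))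

M₁∣mkS⊕1 : ∀ a b c → M₁ ∣ mkS a b (suc c) ⊕ 1ₚ
M₁∣mkS⊕1 a b c = ∣-respʳ P≈S+1 (∣-⊗ˡ ((X ^ₚ a) *ₚ (X+1 ^ₚ b)) (∣-respʳ (≈-sym (^-suc M₁ c)) (M₁ ^ₚ c , ⊗-comm (M₁ ^ₚ c) M₁)))
  where
  P : Poly
  P = (X ^ₚ a) *ₚ (X+1 ^ₚ b)
  P≈S+1 : P ⊗ M₁ ^ₚ suc c ≈ mkS a b (suc c) ⊕ 1ₚ
  P≈S+1 = begin
    P ⊗ M₁ ^ₚ suc c                         ≈⟨ norm-≈ (P ⊗ M₁ ^ₚ suc c) ⟨
    P *ₚ M₁ ^ₚ suc c                        ≈⟨ ⊕-cancel 1ₚ (P *ₚ M₁ ^ₚ suc c) ⟨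
    1ₚ ⊕ (1ₚ ⊕ P *ₚ M₁ ^ₚ suc c)            ≈⟨ ⊕-comm 1ₚ (1ₚ ⊕ P *ₚ M₁ ^ₚ suc c) ⟩
    (1ₚ ⊕ P *ₚ M₁ ^ₚ suc c) ⊕ 1ₚ            ≈⟨ ⊕-cong (norm-≈ (1ₚ ⊕ P *ₚ M₁ ^ₚ suc c)) (≈-refl {1ₚ}) ⟨
    mkS a b (suc c) ⊕ 1ₚ                    ∎
    where open ≈-Reasoning

M₁∤σ-mkS-even-power : ∀ a b c δ → length (mkS a b (suc c)) ≡ suc (suc δ) →
  True (all? (λ d → noFactorOfDegree? (mkS a b (suc c)) (suc d)) (upTo δ)) →
  ∀ h → ¬ (M₁ ∣ₚ σ (mkS a b (suc c) ^ₚ (2 * suc h)))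
M₁∤σ-mkS-even-power a b c δ S≡2+δ checked h M₁∣σ =
  σ-even-power-not-divisible mS S≡2+δ (irreducible-by-trial-division mS S≡2+δ (toWitness checked))
    (cons true (cons true one)) (λ ()) (M₁∣mkS⊕1 a b c) (suc h) (∣ₚ⇒∣ M₁∣σ)
  where
  mS : Monic (mkS a b (suc c))
  mS = normal-nonempty (normal-norm (1ₚ ⊕ (X ^ₚ a) *ₚ (X+1 ^ₚ b) *ₚ (M₁ ^ₚ suc c))) (subst (1 ≤_) (sym S≡2+δ) (s≤s z≤n))

lemma2p12 : (S : Poly) → S ∈ SList → (h : ℕ) → ¬ (M₁ ∣ₚ σ (S ^ₚ (2 * suc h)))
lemma2p12 S S∈SList = lookup each S∈SList
  where
  open import Data.List.Relation.Unary.All using ([]; _∷_)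
  -- S = mkS a b (suc c) of degree suc δ; the trial divisions are checked by evaluation.
  each : All (λ S → (h : ℕ) → ¬ (M₁ ∣ₚ σ (S ^ₚ (2 * suc h)))) SList
  each = M₁∤σ-mkS-even-power 1 1 0 3 refl _
       ∷ M₁∤σ-mkS-even-power 2 2 0 5 refl _
       ∷ M₁∤σ-mkS-even-power 1 3 3 11 refl _
       ∷ M₁∤σ-mkS-even-power 3 1 0 5 refl _
       ∷ M₁∤σ-mkS-even-power 1 3 0 5 refl _
       ∷ M₁∤σ-mkS-even-power 3 1 3 11 refl _
       ∷ M₁∤σ-mkS-even-power 1 1 2 7 refl _
       ∷ M₁∤σ-mkS-even-power 3 3 0 7 refl _
       ∷ M₁∤σ-mkS-even-power 1 1 4 11 refl _
       ∷ M₁∤σ-mkS-even-power 4 1 0 6 refl _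
       ∷ M₁∤σ-mkS-even-power 1 2 0 4 refl _
       ∷ M₁∤σ-mkS-even-power 2 1 1 6 refl _
       ∷ M₁∤σ-mkS-even-power 1 4 0 6 refl _
       ∷ M₁∤σ-mkS-even-power 2 1 0 4 refl _
       ∷ M₁∤σ-mkS-even-power 1 2 1 6 refl _
       ∷ []
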